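{- Let $H$ be an unweighted $k$-colorable strongly canonical clump graph with layers $L_0,\ldots,L_D$. Then: (i) $|L_0|=|L_D|=1$; (ii) if $|L_i|=k$, then $2\le i\le D-1$ and $\min(|L_{i-1}|,|L_{i+1}|)\ge 2$; (iii) for each $i\in\{1,\ldots,D\}$, the pairs $\{y,z\}$ with $y\in L_{i-1}$, $z\in L_i$ that are not edges of $H$ form a matching of size $\max(k,|L_{i-1}|+|L_i|)-k$.
   Context: Fix $k\ge 3$. A graph $G$ is $k$-colored if a fixed proper coloring of its vertices with colors from $\{1,\ldots,k\}$ is given. A connected graph $G$ is layered if a vertex $x$ whose eccentricity equals $D=\operatorname{diam}(G)$ is fixed, together with the layers $L_0=\{x\},L_1,\ldots,L_D$, where $L_i$ is the set of vertices at distance $i$ from $x$. Let $c(i)$ be the number of colors used on $L_i$. $G$ is saturated if any two differently colored vertices lying in the same layer, or in two consecutive layers, are adjacent. Such a $G$ is called canonical if for every $0\le i\le D-1$: (a) if $c(i)=1$ then $c(i+1)\le k-1$; (b) the number of colors used on $L_i\cup L_{i+1}$ is $\min(k,c(i)+c(i+1))$; (c) if $c(i)=k$ then $i\ge 2$ and $c(i+1)\ge 2$; (d) if $L_i$ contains two vertices of the same color, then $i>0$ and $c(i)+\max(c(i-1),c(i+1))\ge k$. A clump of $G$ is a nonempty set of all vertices of some layer $L_i$ having a given color. The (unweighted) clump graph $H=H(G)$ has the clumps of $G$ as vertices, two clumps being adjacent iff some edge of $G$ joins a vertex of one to a vertex of the other; $H$ inherits the coloring (each clump gets its color) and the layering (the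 layer $L_i$ of $H$ is the set of clumps contained in layer $L_i$ of $G$, so $|L_i|=c(i)$ in $H$). An unweighted $k$-colorable strongly canonical clump graph is a clump graph $H=H(G)$ where $D\ge 2$ and $G$ is a saturated, $k$-colored, layered, connected, canonical graph with $c(0)=c(D)=1$. -}

module Defs where

open import Data.Nat using (ℕ; zero; suc; _+_; _∸_; _≤_; _<_; _⊓_; _⊔_)
open import Data.Fin using (Fin)
open import Data.Product using (Σ; ∃; ∃-syntax; _×_; _,_)
open import Data.Sum using (_⊎_)
open import Relation.Nullary using (¬_)
open import Relation.Binary.PropositionalEquality using (_≡_; _≢_)
open import Relation.Binary using (Decidable)
open import Function.Definitions using (Injective)
open import Function.Bundles using (_⇔_)

record Graph : Set₁ where
  field
    n          : ℕ
    Adj        : Fin n → Fin n → Set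
    adj?       : Decidable Adj
    adj-sym    : ∀ {u v} → Adj u v → Adj v u
    adj-irrefl : ∀ {u} → ¬ Adj u u
open Graph public

Vertex : Graph → Set
Vertex G = Fin (n G)

data Walk (G : Graph) : Vertex G → Vertex G → ℕ → Set where
  here : ∀ {u} → Walk G u u 0
  step : ∀ {u v w ℓ} → Adj G u v → Walk G v w ℓ → Walk G u w (suc ℓ)

Connected : Graph → Set
Connected G = ∀ u v → ∃[ ℓ ] Walk G u v ℓ

Dist : (G : Graph) → Vertex G → Vertex G → ℕ → Set
Dist G u v d = Walk G u v d × (∀ m → m < d → ¬ Walk G u v m)

Eccentricity : (G : Graph) → Vertex G → ℕ → Set
Eccentricity G x e = (∀ v d → Dist G x v d → d ≤ e) × (∃[ v ] Dist G x v e)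

Diameter : Graph → ℕ → Set
Diameter G D = (∀ u v d → Dist G u v d → d ≤ D) × (∃[ u ] ∃[ v ] Dist G u v D)

ProperColoring : (G : Graph) {k : ℕ} → (Vertex G → Fin k) → Set
ProperColoring G col = ∀ {u v} → Adj G u v → col u ≢ col v

HasSize : {A : Set} → (A → Set) → ℕ → Set
HasSize {A} P m =
  Σ (Fin m → A) λ f → Injective _≡_ _≡_ f × (∀ a → P a ⇔ (∃[ j ] f j ≡ a))

module Setting (k : ℕ) (G : Graph) (col : Vertex G → Fin k)
               (x : Vertex G) (D : ℕ) where

  L : ℕ → Vertex G → Set
  L i v = Dist G x v i

  ColorsOn : (Vertex G → Set) → Fin k → Set
  ColorsOn S a = ∃[ v ] (S v × col v ≡ a)

  c : ℕ → ℕ → Set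
  c i m = HasSize (ColorsOn (L i)) m

  c∪ : ℕ → ℕ → Set
  c∪ i m = HasSize (ColorsOn (λ v → L i v ⊎ L (suc i) v)) m

  Saturated : Set
  Saturated = ∀ i j u v → L i u → L j v →
              (j ≡ i ⊎ j ≡ suc i ⊎ i ≡ suc j) → col u ≢ col v → Adj G u v

  CanonA : Set
  CanonA = ∀ i → i < D → c i 1 → ∀ m → c (suc i) m → m ≤ k ∸ 1

  CanonB : Set
  CanonB = ∀ i → i < D → ∀ m m′ p → c i m → c (suc i) m′ → c∪ i p →
           p ≡ k ⊓ (m + m′)

  CanonC : Set
  CanonC = ∀ i → i < D → c i k → 2 ≤ i × (∀ m → c (suc i) m → 2 ≤ m)

  CanonD : Set
  CanonD = ∀ i → i < D → ∀ u v → L i u → L i v → u ≢ v → col u ≡ col v →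
           0 < i × (∀ m₋ m m₊ → c (i ∸ 1) m₋ → c i m → c (suc i) m₊ →
                    k ≤ m + (m₋ ⊔ m₊))

  Canonical : Set
  Canonical = CanonA × CanonB × CanonC × CanonD

  -- The clump graph H = H(G).  The clump "all vertices of L_i of color a"
  -- is encoded by the pair (i , a); it is a clump iff it is nonempty.

  Clump : ℕ × Fin k → Set
  Clump (i , a) = ∃[ v ] (L i v × col v ≡ a)

  HAdj : ℕ × Fin k → ℕ × Fin k → Set
  HAdj (i , a) (j , b) =
    ∃[ u ] ∃[ v ] (L i u × col u ≡ a × L j v × col v ≡ b × Adj G u v)

  HLayer : ℕ → ℕ × Fin k → Set
  HLayer i (j , a) = j ≡ i × Clump (j , a)

  HLayerSize : ℕ → ℕ → Set
  HLayerSize i m = HasSize (HLayer i) m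

  NonEdge : ℕ → (ℕ × Fin k) × (ℕ × Fin k) → Set
  NonEdge i (y , z) = HLayer (i ∸ 1) y × HLayer i z × ¬ HAdj y z

-- a set R of pairs (y , z) is a matching (y's and z's lie in disjoint layers)
IsMatching : {A : Set} → (A × A → Set) → Set
IsMatching R = (∀ y z z′ → R (y , z) → R (y , z′) → z ≡ z′)
             × (∀ y y′ z → R (y , z) → R (y′ , z) → y ≡ y′)

module Submission where

-- In H the layer L_i is just the set of colors used on L_i of G, so (i) is c(0) = c(D) = 1 and
-- (ii) is canonicity (c) together with (a) applied at i - 1.  For (iii), saturation and properness
-- say that a clump of L_{i-1} and a clump of L_i are non-adjacent exactly when they have the same
-- color; so the non-edges form a matching indexed by the colors common to both layers, and by
-- inclusion–exclusion and (b) there are c(i-1) + c(i) - min(k, c(i-1) + c(i)) of them.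

open import Defs
open import Data.Nat using (ℕ; zero; suc; _+_; _∸_; _≤_; _<_; _⊓_; _⊔_; z≤n; s≤s)
open import Data.Nat.Properties
  using (≤-trans; ≤-antisym; m+n∸m≡n; n≤1+n; 1+n≰n; m≤n⇒m<n∨m≡n; +-suc; n∸n≡0; ⊔-identityʳ; ⊓-glb;
         ∸-distribˡ-⊓-⊔; ∸-distribʳ-⊔)
open import Data.Fin using (Fin; zero; suc)
import Data.Fin.Properties as Fin
open import Data.Fin.Subset using (Subset; inside; outside; _∈_; _∪_; _∩_; ∣_∣)
open import Data.Fin.Subset.Properties using (x∈p∪q⁺; x∈p∪q⁻; x∈p∩q⁺; x∈p∩q⁻)
open import Data.Vec using ([]; _∷_; here; there)
open import Data.Product using (∃; ∃-syntax; _×_; _,_; proj₁; proj₂)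
open import Data.Sum using (_⊎_; inj₁; inj₂)
open import Data.Empty using (⊥-elim)
open import Relation.Nullary using (¬_; yes; no; does)
open import Relation.Unary using (Decidable)
import Relation.Nullary.Decidable as Dec
open import Relation.Binary.PropositionalEquality
  using (_≡_; refl; sym; trans; cong; cong₂; subst; module ≡-Reasoning)
open import Function.Base using (_∘_)
open import Function.Bundles using (_⇔_; mk⇔; Equivalence)
open import Function.Definitions using (Injective)

open Equivalence using (to; from)

module _ {A : Set} where

  HasSize-resp : {P Q : A → Set} → (∀ a → P a ⇔ Q a) → ∀ {m} → HasSize P m → HasSize Q m
  HasSize-resp P⇔Q (f , f-inj , f-enum) =
    f , f-inj , λ a → mk⇔ (λ q → to (f-enum a) (from (P⇔Q a) q))
                          (λ j → to (P⇔Q a) (from (f-enum a) j))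

  HasSize-unique : {P : A → Set} {m m′ : ℕ} → HasSize P m → HasSize P m′ → m ≡ m′
  HasSize-unique {P} s t = ≤-antisym (size-≤ s t) (size-≤ t s)
    where
    -- each enumeration of P factors injectively through the other one
    size-≤ : ∀ {m m′} → HasSize P m → HasSize P m′ → m ≤ m′
    size-≤ (f , f-inj , f-enum) (g , g-inj , g-enum) = Fin.injective⇒≤ h-inj
      where
      index : ∀ j → ∃[ j′ ] g j′ ≡ f j
      index j = to (g-enum (f j)) (from (f-enum (f j)) (j , refl))
      h-inj : Injective _≡_ _≡_ (λ j → proj₁ (index j))
      h-inj {j₁} {j₂} eq =
        f-inj (trans (sym (proj₂ (index j₁))) (trans (cong g eq) (proj₂ (index j₂))))

  HasSize-nonempty : {P : A → Set} {m : ℕ} → 1 ≤ m → HasSize P m → ∃ P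
  HasSize-nonempty {m = suc _} _ (f , _ , f-enum) = f zero , from (f-enum (f zero)) (zero , refl)

  HasSize-0⇒empty : {P : A → Set} → HasSize P 0 → ∀ a → ¬ P a
  HasSize-0⇒empty (_ , _ , f-enum) a pa = Fin.¬Fin0 (proj₁ (to (f-enum a) pa))

  HasSize-image : {B : Set} {P : A → Set} {R : B → Set} (h : A → B) →
    (∀ {a a′} → P a → P a′ → h a ≡ h a′ → a ≡ a′) →
    (∀ b → R b ⇔ (∃[ a ] (P a × h a ≡ b))) → ∀ {m} → HasSize P m → HasSize R m
  HasSize-image {P = P} {R} h h-inj R⇔image (f , f-inj , f-enum) =
    (λ j → h (f j)) , (λ eq → f-inj (h-inj (P-f _) (P-f _) eq)) , enum
    where
    P-f : ∀ j → P (f j)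
    P-f j = from (f-enum (f j)) (j , refl)
    enum : ∀ b → R b ⇔ (∃[ j ] h (f j) ≡ b)
    enum b = mk⇔ (λ r → let a , pa , ha≡b = to (R⇔image b) r
                            j , fj≡a = to (f-enum a) pa
                        in j , trans (cong h fj≡a) ha≡b)
                 (λ { (j , hfj≡b) → from (R⇔image b) (f j , P-f j , hfj≡b) })

HasSize-∈ : ∀ {n} (p : Subset n) → HasSize (_∈ p) ∣ p ∣
HasSize-∈ [] = (λ ()) , (λ {}) , λ ()
HasSize-∈ (outside ∷ p) with HasSize-∈ p
... | f , f-inj , f-enum = (λ j → suc (f j)) , (λ eq → f-inj (Fin.suc-injective eq)) , enum
  where
  enum : ∀ a → a ∈ outside ∷ p ⇔ (∃[ j ] suc (f j) ≡ a)
  enum zero = mk⇔ (λ ()) (λ ())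
  enum (suc a) =
    mk⇔ (λ { (there a∈p) → let j , fj≡a = to (f-enum a) a∈p in j , cong suc fj≡a })
        (λ { (j , fj≡a) → there (from (f-enum a) (j , Fin.suc-injective fj≡a)) })
HasSize-∈ (inside ∷ p) with HasSize-∈ p
... | f , f-inj , f-enum = g , g-inj , enum
  where
  g : Fin (suc ∣ p ∣) → Fin _
  g zero = zero
  g (suc j) = suc (f j)
  g-inj : Injective _≡_ _≡_ g
  g-inj {zero} {zero} _ = refl
  g-inj {suc _} {suc _} eq = cong suc (f-inj (Fin.suc-injective eq))
  enum : ∀ a → a ∈ inside ∷ p ⇔ (∃[ j ] g j ≡ a)
  enum zero = mk⇔ (λ _ → zero , refl) (λ _ → here)
  enum (suc a) =
    mk⇔ (λ { (there a∈p) → let j , fj≡a = to (f-enum a) a∈p in suc j , cong suc fj≡a })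
        (λ { (zero , ()) ; (suc j , fj≡a) → there (from (f-enum a) (j , Fin.suc-injective fj≡a)) })

∣p∪q∣+∣p∩q∣≡∣p∣+∣q∣ : ∀ {n} (p q : Subset n) → ∣ p ∪ q ∣ + ∣ p ∩ q ∣ ≡ ∣ p ∣ + ∣ q ∣
∣p∪q∣+∣p∩q∣≡∣p∣+∣q∣ [] [] = refl
∣p∪q∣+∣p∩q∣≡∣p∣+∣q∣ (outside ∷ p) (outside ∷ q) = ∣p∪q∣+∣p∩q∣≡∣p∣+∣q∣ p q
∣p∪q∣+∣p∩q∣≡∣p∣+∣q∣ (inside ∷ p) (outside ∷ q) = cong suc (∣p∪q∣+∣p∩q∣≡∣p∣+∣q∣ p q)
∣p∪q∣+∣p∩q∣≡∣p∣+∣q∣ (outside ∷ p) (inside ∷ q) =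
  trans (cong suc (∣p∪q∣+∣p∩q∣≡∣p∣+∣q∣ p q)) (sym (+-suc ∣ p ∣ ∣ q ∣))
∣p∪q∣+∣p∩q∣≡∣p∣+∣q∣ (inside ∷ p) (inside ∷ q) =
  cong suc (trans (+-suc ∣ p ∪ q ∣ ∣ p ∩ q ∣)
    (trans (cong suc (∣p∪q∣+∣p∩q∣≡∣p∣+∣q∣ p q)) (sym (+-suc ∣ p ∣ ∣ q ∣))))

subset : ∀ {n} {P : Fin n → Set} → Decidable P → Subset n
subset {zero} _ = []
subset {suc n} P? = does (P? zero) ∷ subset (λ a → P? (suc a))

∈-subset : ∀ {n} {P : Fin n → Set} (P? : Decidable P) → ∀ a → a ∈ subset P? ⇔ P a
∈-subset P? zero with P? zero
... | yes p = mk⇔ (λ _ → p) (λ _ → here)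
... | no ¬p = mk⇔ (λ ()) (λ p → ⊥-elim (¬p p))
∈-subset P? (suc a) = mk⇔ (λ { (there a∈p) → to (∈-subset (λ b → P? (suc b)) a) a∈p })
                          (λ pa → there (from (∈-subset (λ b → P? (suc b)) a) pa))

HasSize⇒Decidable : ∀ {n m} {P : Fin n → Set} → HasSize P m → Decidable P
HasSize⇒Decidable (f , _ , f-enum) a =
  Dec.map (mk⇔ (from (f-enum a)) (to (f-enum a))) (Fin.any? (λ j → f j Fin.≟ a))

inclusion-exclusion : ∀ {n m m′} {P Q : Fin n → Set} → HasSize P m → HasSize Q m′ →
  ∃[ u ] (HasSize (λ a → P a ⊎ Q a) u × HasSize (λ a → P a × Q a) (m + m′ ∸ u))
inclusion-exclusion {n} {m} {m′} {P} {Q} sP sQ =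
  ∣ p ∪ q ∣ ,
  HasSize-resp ∈p∪q (HasSize-∈ (p ∪ q)) ,
  subst (HasSize _) ∣p∩q∣≡ (HasSize-resp ∈p∩q (HasSize-∈ (p ∩ q)))
  where
  p q : Subset n
  p = subset (HasSize⇒Decidable sP)
  q = subset (HasSize⇒Decidable sQ)
  ∈p : ∀ a → a ∈ p ⇔ P a
  ∈p = ∈-subset (HasSize⇒Decidable sP)
  ∈q : ∀ a → a ∈ q ⇔ Q a
  ∈q = ∈-subset (HasSize⇒Decidable sQ)
  ∈p∪q : ∀ a → a ∈ p ∪ q ⇔ (P a ⊎ Q a)
  ∈p∪q a = mk⇔ (λ a∈ → Data.Sum.map (to (∈p a)) (to (∈q a)) (x∈p∪q⁻ p q a∈))
               (λ pq → x∈p∪q⁺ (Data.Sum.map (from (∈p a)) (from (∈q a)) pq))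
  ∈p∩q : ∀ a → a ∈ p ∩ q ⇔ (P a × Q a)
  ∈p∩q a = mk⇔ (λ a∈ → Data.Product.map (to (∈p a)) (to (∈q a)) (x∈p∩q⁻ p q a∈))
               (λ pq → x∈p∩q⁺ (Data.Product.map (from (∈p a)) (from (∈q a)) pq))
  ∣p∩q∣≡ : ∣ p ∩ q ∣ ≡ m + m′ ∸ ∣ p ∪ q ∣
  ∣p∩q∣≡ = begin
    ∣ p ∩ q ∣                         ≡⟨ m+n∸m≡n ∣ p ∪ q ∣ ∣ p ∩ q ∣ ⟨
    ∣ p ∪ q ∣ + ∣ p ∩ q ∣ ∸ ∣ p ∪ q ∣ ≡⟨ cong (_∸ ∣ p ∪ q ∣) (∣p∪q∣+∣p∩q∣≡∣p∣+∣q∣ p q) ⟩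
    ∣ p ∣ + ∣ q ∣ ∸ ∣ p ∪ q ∣         ≡⟨ cong₂ (λ s t → s + t ∸ ∣ p ∪ q ∣) ∣p∣≡m ∣q∣≡m′ ⟩
    m + m′ ∸ ∣ p ∪ q ∣                ∎
    where
    open ≡-Reasoning
    ∣p∣≡m : ∣ p ∣ ≡ m
    ∣p∣≡m = HasSize-unique (HasSize-resp ∈p (HasSize-∈ p)) sP
    ∣q∣≡m′ : ∣ q ∣ ≡ m′
    ∣q∣≡m′ = HasSize-unique (HasSize-resp ∈q (HasSize-∈ q)) sQ

n∸[m⊓n]≡[m⊔n]∸m : ∀ m n → n ∸ (m ⊓ n) ≡ (m ⊔ n) ∸ m
n∸[m⊓n]≡[m⊔n]∸m m n = begin
  n ∸ (m ⊓ n)             ≡⟨ ∸-distribˡ-⊓-⊔ n m n ⟩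
  (n ∸ m) ⊔ (n ∸ n)       ≡⟨ cong ((n ∸ m) ⊔_) (n∸n≡0 n) ⟩
  (n ∸ m) ⊔ 0             ≡⟨ ⊔-identityʳ (n ∸ m) ⟩
  n ∸ m                   ≡⟨ cong (_⊔ (n ∸ m)) (n∸n≡0 m) ⟨
  (m ∸ m) ⊔ (n ∸ m)       ≡⟨ ∸-distribʳ-⊔ m m n ⟨
  (m ⊔ n) ∸ m             ∎
  where open ≡-Reasoning

module _ (G : Graph) where

  Walk-snoc : ∀ {u v w ℓ} → Walk G u v ℓ → Adj G v w → Walk G u w (suc ℓ)
  Walk-snoc here vw = step vw here
  Walk-snoc (step uu′ p) vw = step uu′ (Walk-snoc p vw)

  Walk-unsnoc : ∀ {u w ℓ} → Walk G u w (suc ℓ) → ∃[ v ] (Walk G u v ℓ × Adj G v w)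
  Walk-unsnoc (step uw here) = _ , here , uw
  Walk-unsnoc (step uu′ (step u′u″ p)) =
    let v , q , vw = Walk-unsnoc (step u′u″ p) in v , step uu′ q , vw

  Dist-pred : ∀ {x w ℓ} → Dist G x w (suc ℓ) → ∃[ v ] Dist G x v ℓ
  Dist-pred (p , shortest) =
    let v , q , vw = Walk-unsnoc p
    in v , q , λ m m<ℓ q′ → shortest (suc m) (s≤s m<ℓ) (Walk-snoc q′ vw)

module ClumpGraph (k : ℕ) (G : Graph) (col : Vertex G → Fin k) (x : Vertex G) (D : ℕ) where
  open Setting k G col x D public

  c⇒HLayerSize : ∀ {i m} → c i m → HLayerSize i m
  c⇒HLayerSize {i} = HasSize-image (i ,_) (λ _ _ → cong proj₂) layer⇔image
    where
    layer⇔image : ∀ b → HLayer i b ⇔ (∃[ a ] (ColorsOn (L i) a × (i , a) ≡ b))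
    layer⇔image (j , a) = mk⇔ (λ { (refl , clump) → a , clump , refl })
                              (λ { (a , clump , refl) → refl , clump })

  HLayerSize⇒c : ∀ {i m} → HLayerSize i m → c i m
  HLayerSize⇒c {i} = HasSize-image proj₂ same-layer color⇔image
    where
    same-layer : ∀ {y y′} → HLayer i y → HLayer i y′ → proj₂ y ≡ proj₂ y′ → y ≡ y′
    same-layer (refl , _) (refl , _) refl = refl
    color⇔image : ∀ a → ColorsOn (L i) a ⇔ (∃[ y ] (HLayer i y × proj₂ y ≡ a))
    color⇔image a = mk⇔ (λ clump → (i , a) , (refl , clump) , refl)
                         (λ { ((_ , a) , (refl , clump) , refl) → clump })

  c-positive : ∀ {i m v} → L i v → c i m → 1 ≤ m
  c-positive {m = zero} {v} v∈Lᵢ c0 = ⊥-elim (HasSize-0⇒empty c0 (col v) (v , v∈Lᵢ , refl))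
  c-positive {m = suc _} _ _ = s≤s z≤n

  ColorsOn-⊎ : ∀ {S T : Vertex G → Set} a →
    (ColorsOn S a ⊎ ColorsOn T a) ⇔ ColorsOn (λ v → S v ⊎ T v) a
  ColorsOn-⊎ a = mk⇔ (λ { (inj₁ (v , v∈S , v-a)) → v , inj₁ v∈S , v-a
                         ; (inj₂ (v , v∈T , v-a)) → v , inj₂ v∈T , v-a })
                     (λ { (v , inj₁ v∈S , v-a) → inj₁ (v , v∈S , v-a)
                        ; (v , inj₂ v∈T , v-a) → inj₂ (v , v∈T , v-a) })

  SharedColor : ℕ → Fin k → Set
  SharedColor j a = ColorsOn (L j) a × ColorsOn (L (suc j)) a

  diagonal : ℕ → Fin k → (ℕ × Fin k) × (ℕ × Fin k)
  diagonal j a = (j , a) , (suc j , a)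

  NonEdge⇔SharedColor : ProperColoring G col → Saturated → ∀ j p →
    NonEdge (suc j) p ⇔ (∃[ a ] (SharedColor j a × diagonal j a ≡ p))
  NonEdge⇔SharedColor proper saturated j ((i , a) , (i′ , b)) = mk⇔ shared non-edge
    where
    shared : NonEdge (suc j) ((i , a) , (i′ , b)) →
             ∃[ a′ ] (SharedColor j a′ × diagonal j a′ ≡ ((i , a) , (i′ , b)))
    shared ((refl , (u , u∈L , u-a)) , (refl , (v , v∈L , v-b)) , ¬adj) with a Fin.≟ b
    ... | yes refl = a , ((u , u∈L , u-a) , (v , v∈L , v-b)) , refl
    ... | no a≢b = ⊥-elim (¬adj (u , v , u∈L , u-a , v∈L , v-b ,
                     saturated j (suc j) u v u∈L v∈L (inj₂ (inj₁ refl))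
                               (λ eq → a≢b (trans (sym u-a) (trans eq v-b)))))
    non-edge : ∃[ a′ ] (SharedColor j a′ × diagonal j a′ ≡ ((i , a) , (i′ , b))) →
               NonEdge (suc j) ((i , a) , (i′ , b))
    non-edge (a , (clump , clump′) , refl) =
      (refl , clump) , (refl , clump′) ,
      λ { (u , v , _ , u-a , _ , v-a , adj) → proper adj (trans u-a (sym v-a)) }

  NonEdge-matching : ProperColoring G col → Saturated → ∀ j → IsMatching (NonEdge (suc j))
  NonEdge-matching proper saturated j =
    (λ _ _ _ r r′ → same-target (to (shared _) r) (to (shared _) r′)) ,
    (λ _ _ _ r r′ → same-source (to (shared _) r) (to (shared _) r′))
    where
    shared : ∀ p → NonEdge (suc j) p ⇔ (∃[ a ] (SharedColor j a × diagonal j a ≡ p))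
    shared = NonEdge⇔SharedColor proper saturated j
    same-target : ∀ {y z z′} → ∃[ a ] (SharedColor j a × diagonal j a ≡ (y , z)) →
                  ∃[ a ] (SharedColor j a × diagonal j a ≡ (y , z′)) → z ≡ z′
    same-target (_ , _ , refl) (_ , _ , refl) = refl
    same-source : ∀ {y y′ z} → ∃[ a ] (SharedColor j a × diagonal j a ≡ (y , z)) →
                  ∃[ a ] (SharedColor j a × diagonal j a ≡ (y′ , z)) → y ≡ y′
    same-source (_ , _ , refl) (_ , _ , refl) = refl

  NonEdge-size : ProperColoring G col → Saturated → CanonB → ∀ {j} → j < D →
    ∀ {m m′} → HLayerSize j m → HLayerSize (suc j) m′ →
    HasSize (NonEdge (suc j)) ((k ⊔ (m + m′)) ∸ k)
  NonEdge-size proper saturated canonB {j} j<D {m} {m′} sⱼ sⱼ₊₁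
    with inclusion-exclusion (HLayerSize⇒c sⱼ) (HLayerSize⇒c sⱼ₊₁)
  ... | u , union , shared =
    HasSize-image (diagonal j) (λ _ _ → cong (proj₂ ∘ proj₁))
      (NonEdge⇔SharedColor proper saturated j)
      (subst (HasSize (SharedColor j)) m+m′∸u≡ shared)
    where
    u≡ : u ≡ k ⊓ (m + m′)
    u≡ = canonB j j<D m m′ u (HLayerSize⇒c sⱼ) (HLayerSize⇒c sⱼ₊₁) (HasSize-resp ColorsOn-⊎ union)
    m+m′∸u≡ : m + m′ ∸ u ≡ (k ⊔ (m + m′)) ∸ k
    m+m′∸u≡ = trans (cong (m + m′ ∸_) u≡) (n∸[m⊓n]≡[m⊔n]∸m k (m + m′))

  full-layer-<D : 2 ≤ k → Eccentricity G x D → c D 1 → ∀ {i} → c i k → i < D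
  full-layer-<D 2≤k ecc cD {i} cᵢ with HasSize-nonempty (≤-trans (n≤1+n 1) 2≤k) cᵢ
  ... | _ , v , v∈Lᵢ , _ with m≤n⇒m<n∨m≡n (proj₁ ecc v i v∈Lᵢ)
  ...   | inj₁ i<D = i<D
  ...   | inj₂ refl = ⊥-elim (1+n≰n (subst (2 ≤_) (HasSize-unique cᵢ cD) 2≤k))

  -- (a) forbids c(i-1) = 1 and L_{i-1} ≠ ∅ forbids c(i-1) = 0
  before-full-layer : 1 ≤ k → CanonA → ∀ {i} → 1 ≤ i → i < D → c i k →
    ∀ {m} → c (i ∸ 1) m → 2 ≤ m
  before-full-layer 1≤k canonA {suc j} _ i<D cᵢ {m} cⱼ with HasSize-nonempty 1≤k cᵢ
  ... | _ , w , w∈Lᵢ , _ = at-least-two m cⱼ (c-positive (proj₂ (Dist-pred G w∈Lᵢ)) cⱼ)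
    where
    n≰n∸1 : ∀ n → 1 ≤ n → ¬ n ≤ n ∸ 1
    n≰n∸1 (suc n) _ = 1+n≰n
    at-least-two : ∀ m → c j m → 1 ≤ m → 2 ≤ m
    at-least-two (suc zero) c1 _ =
      ⊥-elim (n≰n∸1 k 1≤k (canonA j (≤-trans (n≤1+n (suc j)) i<D) c1 k cᵢ))
    at-least-two (suc (suc _)) _ _ = s≤s (s≤s z≤n)

  full-HLayer : 2 ≤ k → Eccentricity G x D → c D 1 → CanonA → CanonC →
    ∀ i → HLayerSize i k →
    2 ≤ i × suc i ≤ D
    × (∀ m₋ m₊ → HLayerSize (i ∸ 1) m₋ → HLayerSize (suc i) m₊ → 2 ≤ m₋ ⊓ m₊)
  full-HLayer 2≤k ecc cD canonA canonC i sᵢ =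
    2≤i , i<D ,
    λ _ _ sᵢ₋₁ sᵢ₊₁ → ⊓-glb (before-full-layer 1≤k canonA 1≤i i<D cᵢ (HLayerSize⇒c sᵢ₋₁))
                           (cᵢ₊₁≥2 _ (HLayerSize⇒c sᵢ₊₁))
    where
    cᵢ : c i k
    cᵢ = HLayerSize⇒c sᵢ
    i<D : i < D
    i<D = full-layer-<D 2≤k ecc cD cᵢ
    2≤i : 2 ≤ i
    2≤i = proj₁ (canonC i i<D cᵢ)
    cᵢ₊₁≥2 : ∀ m → c (suc i) m → 2 ≤ m
    cᵢ₊₁≥2 = proj₂ (canonC i i<D cᵢ)
    1≤k : 1 ≤ k
    1≤k = ≤-trans (n≤1+n 1) 2≤k
    1≤i : 1 ≤ i
    1≤i = ≤-trans (n≤1+n 1) 2≤i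

  consecutive-NonEdge : ProperColoring G col → Saturated → CanonB → ∀ i → 1 ≤ i → i ≤ D →
    IsMatching (NonEdge i)
    × (∀ m m′ → HLayerSize (i ∸ 1) m → HLayerSize i m′ → HasSize (NonEdge i) ((k ⊔ (m + m′)) ∸ k))
  consecutive-NonEdge proper saturated canonB (suc j) _ j<D =
    NonEdge-matching proper saturated j , λ _ _ → NonEdge-size proper saturated canonB j<D

claim4p1 : (k : ℕ) → 3 ≤ k →
    (G : Graph) (col : Vertex G → Fin k) (x : Vertex G) (D : ℕ) →
    ProperColoring G col → Connected G →
    Diameter G D → Eccentricity G x D → 2 ≤ D →
    Setting.Saturated k G col x D → Setting.Canonical k G col x D →
    Setting.c k G col x D 0 1 → Setting.c k G col x D D 1 →
    (Setting.HLayerSize k G col x D 0 1 × Setting.HLayerSize k G col x D D 1)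
    × (∀ i → Setting.HLayerSize k G col x D i k →
         2 ≤ i × suc i ≤ D
         × (∀ m₋ m₊ → Setting.HLayerSize k G col x D (i ∸ 1) m₋ →
              Setting.HLayerSize k G col x D (suc i) m₊ → 2 ≤ m₋ ⊓ m₊))
    × (∀ i → 1 ≤ i → i ≤ D →
         IsMatching (Setting.NonEdge k G col x D i)
         × (∀ m m′ → Setting.HLayerSize k G col x D (i ∸ 1) m →
              Setting.HLayerSize k G col x D i m′ →
              HasSize (Setting.NonEdge k G col x D i) ((k ⊔ (m + m′)) ∸ k)))
claim4p1 k 3≤k G col x D proper _ _ ecc _ saturated (canonA , canonB , canonC , _) c₀ c_D =
  (c⇒HLayerSize c₀ , c⇒HLayerSize c_D) ,
  full-HLayer (≤-trans (n≤1+n 2) 3≤k) ecc c_D canonA canonC ,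
  consecutive-NonEdge proper saturated canonB
  where open ClumpGraph k G col x D
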